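{- Let $\mathbf{C}$ be a convex biproduct category, regarded as a symmetric monoidal category $(\mathbf{C},\oplus,0)$ with associator $\alpha_{X,Y,Z}\colon(X\oplus Y)\oplus Z\to X\oplus(Y\oplus Z)$, left unitor $\lambda$, and symmetry $\sigma$ induced by the coproducts. For each object $X$ and $p\in(0,1)$ let $\Delta^p_X:=\langle\mathrm{id}_X,\mathrm{id}_X\rangle_{p,1-p}\colon X\to X\oplus X$, let $!_X\colon X\to0$ be the unique arrow, and let $\nabla_X:=[\mathrm{id}_X,\mathrm{id}_X]\colon X\oplus X\to X$. Then for all objects $X,Y$, all $p,q\in(0,1)$ and all $f\colon X\to Y$: (1) $\Delta^p_X;(\Delta^q_X\oplus\mathrm{id}_X)=\Delta^{pq}_X;(\mathrm{id}_X\oplus\Delta^{\tilde q}_X);\alpha^{ -1}_{X,X,X}$ where $\tilde q=\frac{p(1-q)}{1-pq}$; (2) $\Delta^p_X;\nabla_X=\mathrm{id}_X$; (3) $\Delta^p_X;\sigma_{X,X}=\Delta^{1-p}_X$; (4) $\Delta^p_{X\oplus Y}=(\Delta^p_X\oplus\Delta^p_Y);\alpha_{X,X,Y\oplus Y};(\mathrm{id}_X\oplus\alpha^{ -1}_{X,Y,Y});(\mathrm{id}_X\oplus(\sigma_{X,Y}\oplus\mathrm{id}_Y));(\mathrm{id}_X\oplus\alpha_{Y,X,Y});\alpha^{ -1}_{X,Y,X\oplus Y}$; (5) $!_{X\oplus Y}=(!_X\oplus\,!_Y);\lambda_0$; (6) $!_0=\mathrm{id}_0$; (7) $\Delta^p_0=\lambda_0^{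 -1}$; (8) $f;\Delta^p_Y=\Delta^p_X;(f\oplus f)$; (9) $f;!_Y=\,!_X$. That is, $(X,\Delta^p_X,!_X)$ is a natural and coherent co-pca.
   Context: Composition is diagrammatic. A pca is a set with $\star$ and $+_p$ ($p\in(0,1)$) satisfying $(x_1+_q x_2)+_p x_3=x_1+_{pq}(x_2+_{\tilde q}x_3)$, $x_1+_px_2=x_2+_{1-p}x_1$, $x+_px=x$; $x+_1y=x$, $x+_0y=y$, $p\cdot x:=x+_p\star$. A PCA-enriched category has pca hom-sets with composition preserving $+_p$ and $\star$ in each argument. A convex biproduct category is a PCA-enriched category with an object $0$ both initial and terminal and, for all $X_1,X_2$, an object $X_1\oplus X_2$ with $\iota_i\colon X_i\to X_1\oplus X_2$ and $\pi_i\colon X_1\oplus X_2\to X_i$ such that it is a coproduct via $\iota_i$, a convex product via $\pi_i$ (for all $p_1,p_2\in[0,1]$, $p_1+p_2\le1$, $f_i\colon A\to X_i$ there is a unique $h=:\langle f_1,f_2\rangle_{p_1,p_2}$ with $h;\pi_i=p_i\cdot f_i$), and $\iota_i;\pi_j=\mathrm{id}$ if $i=j$, $\star$ otherwise. $[f,g]$ denotes copairing. -}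

module Defs where

open import Level using (Level; _⊔_) renaming (suc to lsuc; zero to lzero)
open import Data.Product using (Σ; _×_; _,_)
open import Relation.Binary.PropositionalEquality using (_≡_)
open import Relation.Nullary using (¬_)
open import Algebra.Structures using (IsCommutativeRing)
open import Relation.Binary.Structures using (IsTotalOrder)

-- The real numbers, axiomatised as a Dedekind-complete ordered field.
-- (agda-stdlib has no reals; every complete ordered field is ℝ up to
-- unique isomorphism, so quantifying over all of them is faithful.)

record RealField : Set₁ where
  infixl 6 _+_ _-_
  infixl 7 _*_
  infix 4 _≤_ _<_
  field
    R          : Set
    _+_ _*_    : R → R → R
    -_         : R → R
    0# 1#      : R
    _⁻¹        : R → R
    _≤_        : R → R → Set
    isCommutativeRing : IsCommutativeRing _≡_ _+_ _*_ -_ 0# 1#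
    0≢1        : ¬ (0# ≡ 1#)
    ⁻¹-inverse : ∀ x → ¬ (x ≡ 0#) → x * (x ⁻¹) ≡ 1#
    isTotalOrder : IsTotalOrder _≡_ _≤_
    +-mono-≤   : ∀ {x y} z → x ≤ y → x + z ≤ y + z
    *-nonneg   : ∀ {x y} → 0# ≤ x → 0# ≤ y → 0# ≤ x * y
    complete   : (P : R → Set) → Σ R P → Σ R (λ b → ∀ x → P x → x ≤ b) →
                 Σ R (λ s → (∀ x → P x → x ≤ s) ×
                            (∀ b → (∀ x → P x → x ≤ b) → s ≤ b))

  _-_ : R → R → R
  x - y = x + (- y)

  _<_ : R → R → Set
  x < y = x ≤ y × ¬ (x ≡ y)

  Open01 : R → Set
  Open01 p = 0# < p × p < 1#

  Closed01 : R → Set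
  Closed01 p = 0# ≤ p × p ≤ 1#

  tilde : R → R → R
  tilde p q = (p * (1# - q)) * ((1# - p * q) ⁻¹)

-- The operation  x +⟨ p ⟩ y  is given for
-- every scalar p; only its values for p ∈ [0,1] are constrained, and the
-- conventions x +_1 y = x, x +_0 y = y are imposed as axioms.

module _ (ℝ : RealField) where
  open RealField ℝ

  record IsPCA {h : Level} (A : Set h) (⋆ : A) (_+⟨_⟩_ : A → R → A → A) : Set h where
    field
      pca-assoc : ∀ p q → Open01 p → Open01 q → ∀ x₁ x₂ x₃ →
                  (x₁ +⟨ q ⟩ x₂) +⟨ p ⟩ x₃ ≡ x₁ +⟨ p * q ⟩ (x₂ +⟨ tilde p q ⟩ x₃)
      pca-comm  : ∀ p → Open01 p → ∀ x₁ x₂ → x₁ +⟨ p ⟩ x₂ ≡ x₂ +⟨ 1# - p ⟩ x₁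
      pca-idem  : ∀ p → Open01 p → ∀ x → x +⟨ p ⟩ x ≡ x
      pca-one   : ∀ x y → x +⟨ 1# ⟩ y ≡ x
      pca-zero  : ∀ x y → x +⟨ 0# ⟩ y ≡ y

  record ConvexBiproductCategory (o h : Level) : Set (lsuc (o ⊔ h)) where
    infixr 9 _⨾_
    infixr 6 _⊕_
    field
      Obj  : Set o
      _⇒_  : Obj → Obj → Set h
      id   : ∀ {A} → A ⇒ A
      _⨾_  : ∀ {A B C} → A ⇒ B → B ⇒ C → A ⇒ C
      ⨾-assoc : ∀ {A B C D} (f : A ⇒ B) (g : B ⇒ C) (k : C ⇒ D) →
                (f ⨾ g) ⨾ k ≡ f ⨾ (g ⨾ k)
      ⨾-idˡ : ∀ {A B} (f : A ⇒ B) → id ⨾ f ≡ f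
      ⨾-idʳ : ∀ {A B} (f : A ⇒ B) → f ⨾ id ≡ f

      ⋆      : ∀ {A B} → A ⇒ B
      _+⟨_⟩_ : ∀ {A B} → A ⇒ B → R → A ⇒ B → A ⇒ B
      isPCA  : ∀ {A B} → IsPCA (A ⇒ B) ⋆ _+⟨_⟩_
      ⨾-+ˡ : ∀ {A B C} p → Open01 p → (f g : A ⇒ B) (k : B ⇒ C) →
             (f +⟨ p ⟩ g) ⨾ k ≡ (f ⨾ k) +⟨ p ⟩ (g ⨾ k)
      ⨾-+ʳ : ∀ {A B C} p → Open01 p → (f : A ⇒ B) (g k : B ⇒ C) →
             f ⨾ (g +⟨ p ⟩ k) ≡ (f ⨾ g) +⟨ p ⟩ (f ⨾ k)
      ⨾-⋆ˡ : ∀ {A B C} (k : B ⇒ C) → (⋆ {A} {B}) ⨾ k ≡ ⋆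
      ⨾-⋆ʳ : ∀ {A B C} (f : A ⇒ B) → f ⨾ (⋆ {B} {C}) ≡ ⋆

      𝟘   : Obj
      ¡   : ∀ {A} → 𝟘 ⇒ A
      ¡-unique : ∀ {A} (f : 𝟘 ⇒ A) → f ≡ ¡
      !ₜ  : ∀ {A} → A ⇒ 𝟘
      !ₜ-unique : ∀ {A} (f : A ⇒ 𝟘) → f ≡ !ₜ

      _⊕_ : Obj → Obj → Obj
      ι₁  : ∀ {X₁ X₂} → X₁ ⇒ (X₁ ⊕ X₂)
      ι₂  : ∀ {X₁ X₂} → X₂ ⇒ (X₁ ⊕ X₂)
      π₁  : ∀ {X₁ X₂} → (X₁ ⊕ X₂) ⇒ X₁
      π₂  : ∀ {X₁ X₂} → (X₁ ⊕ X₂) ⇒ X₂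
      [_,_] : ∀ {X₁ X₂ B} → X₁ ⇒ B → X₂ ⇒ B → (X₁ ⊕ X₂) ⇒ B
      ι₁-copair : ∀ {X₁ X₂ B} (f : X₁ ⇒ B) (g : X₂ ⇒ B) → ι₁ ⨾ [ f , g ] ≡ f
      ι₂-copair : ∀ {X₁ X₂ B} (f : X₁ ⇒ B) (g : X₂ ⇒ B) → ι₂ ⨾ [ f , g ] ≡ g
      copair-unique : ∀ {X₁ X₂ B} (f : X₁ ⇒ B) (g : X₂ ⇒ B) (k : (X₁ ⊕ X₂) ⇒ B) →
                      ι₁ ⨾ k ≡ f → ι₂ ⨾ k ≡ g → k ≡ [ f , g ]
      -- convex product: ⟨ f₁ , f₂ ⟩[ p₁ , p₂ ]  (only meaningful when
      -- p₁, p₂ ∈ [0,1] and p₁ + p₂ ≤ 1)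
      ⟨_,_⟩[_,_] : ∀ {A X₁ X₂} → A ⇒ X₁ → A ⇒ X₂ → R → R → A ⇒ (X₁ ⊕ X₂)
      pair-π₁ : ∀ {A X₁ X₂} p₁ p₂ → Closed01 p₁ → Closed01 p₂ → p₁ + p₂ ≤ 1# →
                (f₁ : A ⇒ X₁) (f₂ : A ⇒ X₂) →
                ⟨ f₁ , f₂ ⟩[ p₁ , p₂ ] ⨾ π₁ ≡ f₁ +⟨ p₁ ⟩ ⋆
      pair-π₂ : ∀ {A X₁ X₂} p₁ p₂ → Closed01 p₁ → Closed01 p₂ → p₁ + p₂ ≤ 1# →
                (f₁ : A ⇒ X₁) (f₂ : A ⇒ X₂) →
                ⟨ f₁ , f₂ ⟩[ p₁ , p₂ ] ⨾ π₂ ≡ f₂ +⟨ p₂ ⟩ ⋆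
      pair-unique : ∀ {A X₁ X₂} p₁ p₂ → Closed01 p₁ → Closed01 p₂ → p₁ + p₂ ≤ 1# →
                    (f₁ : A ⇒ X₁) (f₂ : A ⇒ X₂) (k : A ⇒ (X₁ ⊕ X₂)) →
                    k ⨾ π₁ ≡ f₁ +⟨ p₁ ⟩ ⋆ → k ⨾ π₂ ≡ f₂ +⟨ p₂ ⟩ ⋆ →
                    k ≡ ⟨ f₁ , f₂ ⟩[ p₁ , p₂ ]
      ι₁-π₁ : ∀ {X₁ X₂} → ι₁ {X₁} {X₂} ⨾ π₁ ≡ id
      ι₂-π₂ : ∀ {X₁ X₂} → ι₂ {X₁} {X₂} ⨾ π₂ ≡ id
      ι₁-π₂ : ∀ {X₁ X₂} → ι₁ {X₁} {X₂} ⨾ π₂ ≡ ⋆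
      ι₂-π₁ : ∀ {X₁ X₂} → ι₂ {X₁} {X₂} ⨾ π₁ ≡ ⋆

    _⊕₁_ : ∀ {X X' Y Y'} → X ⇒ X' → Y ⇒ Y' → (X ⊕ Y) ⇒ (X' ⊕ Y')
    f ⊕₁ g = [ f ⨾ ι₁ , g ⨾ ι₂ ]

    α : ∀ X Y Z → ((X ⊕ Y) ⊕ Z) ⇒ (X ⊕ (Y ⊕ Z))
    α X Y Z = [ [ ι₁ , ι₁ ⨾ ι₂ ] , ι₂ ⨾ ι₂ ]

    α⁻¹ : ∀ X Y Z → (X ⊕ (Y ⊕ Z)) ⇒ ((X ⊕ Y) ⊕ Z)
    α⁻¹ X Y Z = [ ι₁ ⨾ ι₁ , [ ι₂ ⨾ ι₁ , ι₂ ] ]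

    λu : ∀ X → (𝟘 ⊕ X) ⇒ X
    λu X = [ ¡ , id ]

    λu⁻¹ : ∀ X → X ⇒ (𝟘 ⊕ X)
    λu⁻¹ X = ι₂

    σ : ∀ X Y → (X ⊕ Y) ⇒ (Y ⊕ X)
    σ X Y = [ ι₂ , ι₁ ]

    Δ : ∀ (X : Obj) → R → X ⇒ (X ⊕ X)
    Δ X p = ⟨ id , id ⟩[ p , 1# - p ]

    !_ : ∀ (X : Obj) → X ⇒ 𝟘
    ! X = !ₜ

    ∇ : ∀ (X : Obj) → (X ⊕ X) ⇒ X
    ∇ X = [ id , id ]

-- The key observation is that Δᵖ is the convex combination ι₁ +⟨ p ⟩ ι₂ of the two
-- coproduct injections (both have the same convex projections).  Hence Δᵖ ⨾ [ f , g ]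
-- is f +⟨ p ⟩ g, and each co-pca law becomes a pca law of a hom-set: (1) is
-- associativity, (2) idempotence, (3) commutativity and (8) the enrichment.  The
-- coherence law (4) is checked on the four summand inclusions of (X ⊕ X) ⊕ (Y ⊕ Y),
-- and the laws for ! are uniqueness of maps into and out of the zero object.  The
-- only real arithmetic is that p * q and q̃ = p(1 - q)/(1 - pq) again lie in (0,1),
-- which holds since 0 < p(1 - q) < 1 - pq.
module Submission where

open import Defs
open import Level using (Level; 0ℓ)
open import Algebra.Bundles using (CommutativeRing)
open import Algebra.Structures using (IsCommutativeRing)
open import Data.Product using (_×_; _,_; proj₁; proj₂)
open import Data.Sum using (inj₁; inj₂)
open import Function using (_∘_)
open import Relation.Binary.PropositionalEquality using (_≡_; refl; sym; trans; cong; cong₂; subst; subst₂; module ≡-Reasoning)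
open import Relation.Binary.Structures using (IsTotalOrder)
open import Relation.Nullary using (¬_; contradiction)

module UnitInterval (ℝ : RealField) where
  open RealField ℝ
  open IsCommutativeRing isCommutativeRing
    using (+-assoc; +-comm; +-identityˡ; -‿inverseʳ; *-assoc; *-identityˡ; *-identityʳ; zeroˡ; zeroʳ; distribˡ)
  open IsTotalOrder isTotalOrder using (total; antisym; reflexive) renaming (trans to ≤-trans)

  private
    commutativeRing : CommutativeRing 0ℓ 0ℓ
    commutativeRing = record { isCommutativeRing = isCommutativeRing }

  open import Algebra.Properties.Ring (CommutativeRing.ring commutativeRing)
    using (-‿distribˡ-*; -‿distribʳ-*; [y-z]x≈yx-zx)
  open import Algebra.Properties.AbelianGroup (CommutativeRing.+-abelianGroup commutativeRing)
    using (⁻¹-involutive; ⁻¹-anti-homo‿-; //-rightDividesˡ; \\-leftDividesʳ;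
           x∙y⁻¹≈ε⇒x≈y; x≈y⇒x∙y⁻¹≈ε)

  x≤y⇒0≤y-x : ∀ {x y} → x ≤ y → 0# ≤ y - x
  x≤y⇒0≤y-x {x} {y} x≤y = subst (_≤ y - x) (-‿inverseʳ x) (+-mono-≤ (- x) x≤y)

  0≤y-x⇒x≤y : ∀ {x y} → 0# ≤ y - x → x ≤ y
  0≤y-x⇒x≤y {x} {y} 0≤y-x = subst₂ _≤_ (+-identityˡ x) (//-rightDividesˡ x y) (+-mono-≤ x 0≤y-x)

  x≤0⇒0≤-x : ∀ {x} → x ≤ 0# → 0# ≤ - x
  x≤0⇒0≤-x {x} x≤0 = subst (0# ≤_) (+-identityˡ (- x)) (x≤y⇒0≤y-x x≤0)

  0≤1 : 0# ≤ 1#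
  0≤1 with total 0# 1#
  ... | inj₁ 0≤1 = 0≤1
  ... | inj₂ 1≤0 = subst (0# ≤_) [-1]*[-1]≡1 (*-nonneg 0≤-1 0≤-1)
    where
      0≤-1 : 0# ≤ - 1#
      0≤-1 = x≤0⇒0≤-x 1≤0
      [-1]*[-1]≡1 : (- 1#) * (- 1#) ≡ 1#
      [-1]*[-1]≡1 = trans (sym (-‿distribˡ-* 1# (- 1#))) (trans (cong -_ (*-identityˡ (- 1#))) (⁻¹-involutive 1#))

  *-cancelʳ : ∀ {x y} z → ¬ z ≡ 0# → x * z ≡ y * z → x ≡ y
  *-cancelʳ {x} {y} z z≢0 xz≡yz = begin
    x                ≡⟨ *-identityʳ x ⟨
    x * 1#           ≡⟨ cong (x *_) (⁻¹-inverse z z≢0) ⟨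
    x * (z * z ⁻¹)   ≡⟨ *-assoc x z (z ⁻¹) ⟨
    (x * z) * z ⁻¹   ≡⟨ cong (_* z ⁻¹) xz≡yz ⟩
    (y * z) * z ⁻¹   ≡⟨ *-assoc y z (z ⁻¹) ⟩
    y * (z * z ⁻¹)   ≡⟨ cong (y *_) (⁻¹-inverse z z≢0) ⟩
    y * 1#           ≡⟨ *-identityʳ y ⟩
    y                ∎
    where open ≡-Reasoning

  ≤-<-trans : ∀ {x y z} → x ≤ y → y < z → x < z
  ≤-<-trans x≤y (y≤z , y≢z) = ≤-trans x≤y y≤z , λ x≡z → y≢z (antisym y≤z (subst (_≤ _) x≡z x≤y))

  <-trans : ∀ {x y z} → x < y → y < z → x < z
  <-trans (x≤y , _) = ≤-<-trans x≤y

  x<y⇒0<y-x : ∀ {x y} → x < y → 0# < y - x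
  x<y⇒0<y-x {x} {y} (x≤y , x≢y) = x≤y⇒0≤y-x x≤y , λ 0≡y-x → x≢y (sym (x∙y⁻¹≈ε⇒x≈y y x (sym 0≡y-x)))

  0<y-x⇒x<y : ∀ {x y} → 0# < y - x → x < y
  0<y-x⇒x<y (0≤y-x , 0≢y-x) = 0≤y-x⇒x≤y 0≤y-x , λ x≡y → 0≢y-x (sym (x≈y⇒x∙y⁻¹≈ε (sym x≡y)))

  *-pos : ∀ {x y} → 0# < x → 0# < y → 0# < x * y
  *-pos {y = y} (0≤x , 0≢x) (0≤y , 0≢y) =
    *-nonneg 0≤x 0≤y , λ 0≡xy → 0≢x (sym (*-cancelʳ y (0≢y ∘ sym) (trans (sym 0≡xy) (sym (zeroˡ y)))))

  ⁻¹-pos : ∀ {x} → 0# < x → 0# < x ⁻¹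
  ⁻¹-pos {x} (0≤x , 0≢x) = 0≤x⁻¹ , x⁻¹≢0
    where
      x*x⁻¹≡1 : x * x ⁻¹ ≡ 1#
      x*x⁻¹≡1 = ⁻¹-inverse x (0≢x ∘ sym)
      x⁻¹≢0 : ¬ 0# ≡ x ⁻¹
      x⁻¹≢0 0≡x⁻¹ = 0≢1 (trans (sym (zeroʳ x)) (trans (cong (x *_) 0≡x⁻¹) x*x⁻¹≡1))
      0≤x⁻¹ : 0# ≤ x ⁻¹
      0≤x⁻¹ with total 0# (x ⁻¹)
      ... | inj₁ 0≤x⁻¹ = 0≤x⁻¹
      ... | inj₂ x⁻¹≤0 = contradiction (antisym 0≤1 (0≤y-x⇒x≤y 0≤0-1)) 0≢1
        where
          0≤0-1 : 0# ≤ 0# - 1#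
          0≤0-1 = subst (0# ≤_) (trans (sym (-‿distribʳ-* x (x ⁻¹))) (trans (cong -_ x*x⁻¹≡1) (sym (+-identityˡ (- 1#)))))
                        (*-nonneg 0≤x (x≤0⇒0≤-x x⁻¹≤0))

  *-monoˡ-≤-nonNeg : ∀ {x y z} → 0# ≤ z → x ≤ y → x * z ≤ y * z
  *-monoˡ-≤-nonNeg {x} {y} {z} 0≤z x≤y = 0≤y-x⇒x≤y (subst (0# ≤_) ([y-z]x≈yx-zx z y x) (*-nonneg (x≤y⇒0≤y-x x≤y) 0≤z))

  *-monoˡ-<-pos : ∀ {x y z} → 0# < z → x < y → x * z < y * z
  *-monoˡ-<-pos {z = z} (0≤z , 0≢z) (x≤y , x≢y) =
    *-monoˡ-≤-nonNeg 0≤z x≤y , λ xz≡yz → x≢y (*-cancelʳ z (0≢z ∘ sym) xz≡yz)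

  x+[y-x]≡y : ∀ x y → x + (y - x) ≡ y
  x+[y-x]≡y x y = trans (+-comm x (y - x)) (//-rightDividesˡ x y)

  x-[x-y]≡y : ∀ x y → x - (x - y) ≡ y
  x-[x-y]≡y x y = trans (cong (x +_) (⁻¹-anti-homo‿- x y)) (x+[y-x]≡y x y)

  p+[1-p]≤1 : ∀ p → p + (1# - p) ≤ 1#
  p+[1-p]≤1 p = reflexive (x+[y-x]≡y p 1#)

  Open01⇒Closed01 : ∀ {p} → Open01 p → Closed01 p
  Open01⇒Closed01 ((0≤p , _) , (p≤1 , _)) = 0≤p , p≤1

  Open01-complement : ∀ {p} → Open01 p → Open01 (1# - p)
  Open01-complement {p} (0<p , p<1) = x<y⇒0<y-x p<1 , 0<y-x⇒x<y (subst (0# <_) (sym (x-[x-y]≡y 1# p)) 0<p)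

  Open01-* : ∀ {p q} → Open01 p → Open01 q → Open01 (p * q)
  Open01-* {p} {q} (0<p , p<1) (0<q , q<1) = *-pos 0<p 0<q , ≤-<-trans pq≤q q<1
    where
      pq≤q : p * q ≤ q
      pq≤q = subst (p * q ≤_) (*-identityˡ q) (*-monoˡ-≤-nonNeg (proj₁ 0<q) (proj₁ p<1))

  Open01-quotient : ∀ {x y} → 0# < x → x < y → Open01 (x * y ⁻¹)
  Open01-quotient {x} {y} 0<x x<y =
    *-pos 0<x 0<y⁻¹ , subst (x * y ⁻¹ <_) (⁻¹-inverse y (proj₂ 0<y ∘ sym)) (*-monoˡ-<-pos 0<y⁻¹ x<y)
    where
      0<y : 0# < y
      0<y = <-trans 0<x x<y
      0<y⁻¹ : 0# < y ⁻¹
      0<y⁻¹ = ⁻¹-pos 0<y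

  [1-pq]-p[1-q]≡1-p : ∀ p q → (1# - p * q) - p * (1# - q) ≡ 1# - p
  [1-pq]-p[1-q]≡1-p p q = begin
    (1# - p * q) - p * (1# - q)      ≡⟨ cong (λ z → (1# - p * q) - z) p[1-q]≡p-pq ⟩
    (1# - p * q) - (p - p * q)       ≡⟨ cong ((1# - p * q) +_) (⁻¹-anti-homo‿- p (p * q)) ⟩
    (1# - p * q) + (p * q - p)       ≡⟨ +-assoc 1# (- (p * q)) (p * q - p) ⟩
    1# + (- (p * q) + (p * q - p))   ≡⟨ cong (1# +_) (\\-leftDividesʳ (p * q) (- p)) ⟩
    1# - p                           ∎
    where
      open ≡-Reasoning
      p[1-q]≡p-pq : p * (1# - q) ≡ p - p * q
      p[1-q]≡p-pq = trans (distribˡ p 1# (- q)) (cong₂ _+_ (*-identityʳ p) (sym (-‿distribʳ-* p q)))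

  Open01-tilde : ∀ {p q} → Open01 p → Open01 q → Open01 (tilde p q)
  Open01-tilde {p} {q} (0<p , p<1) 0<q<1 = Open01-quotient 0<p[1-q] p[1-q]<1-pq
    where
      0<p[1-q] : 0# < p * (1# - q)
      0<p[1-q] = *-pos 0<p (proj₁ (Open01-complement 0<q<1))
      p[1-q]<1-pq : p * (1# - q) < 1# - p * q
      p[1-q]<1-pq = 0<y-x⇒x<y (subst (0# <_) (sym ([1-pq]-p[1-q]≡1-p p q)) (x<y⇒0<y-x p<1))

module CoPCA {o h : Level} (ℝ : RealField) (C : ConvexBiproductCategory ℝ o h) where
  open RealField ℝ
  open ConvexBiproductCategory C
  open module PCA {A} {B} = IsPCA (isPCA {A} {B}) using (pca-assoc; pca-comm; pca-idem)
  open UnitInterval ℝ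

  copair-ext : ∀ {X₁ X₂ B} {f g : (X₁ ⊕ X₂) ⇒ B} → ι₁ ⨾ f ≡ ι₁ ⨾ g → ι₂ ⨾ f ≡ ι₂ ⨾ g → f ≡ g
  copair-ext {f = f} {g} ι₁f≡ι₁g ι₂f≡ι₂g =
    trans (copair-unique _ _ f ι₁f≡ι₁g ι₂f≡ι₂g) (sym (copair-unique _ _ g refl refl))

  -- The continuation k lets these rewrite the head of a right-nested composite.

  ι₁-copair-⨾ : ∀ {X₁ X₂ B D} (f : X₁ ⇒ B) (g : X₂ ⇒ B) (k : B ⇒ D) → ι₁ ⨾ [ f , g ] ⨾ k ≡ f ⨾ k
  ι₁-copair-⨾ f g k = trans (sym (⨾-assoc _ _ _)) (cong (_⨾ k) (ι₁-copair f g))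

  ι₂-copair-⨾ : ∀ {X₁ X₂ B D} (f : X₁ ⇒ B) (g : X₂ ⇒ B) (k : B ⇒ D) → ι₂ ⨾ [ f , g ] ⨾ k ≡ g ⨾ k
  ι₂-copair-⨾ f g k = trans (sym (⨾-assoc _ _ _)) (cong (_⨾ k) (ι₂-copair f g))

  ι₁-⊕₁-⨾ : ∀ {X X' Y Y' D} (f : X ⇒ X') (g : Y ⇒ Y') (k : (X' ⊕ Y') ⇒ D) → ι₁ ⨾ (f ⊕₁ g) ⨾ k ≡ f ⨾ ι₁ ⨾ k
  ι₁-⊕₁-⨾ f g k = trans (ι₁-copair-⨾ _ _ k) (⨾-assoc _ _ _)

  ι₂-⊕₁-⨾ : ∀ {X X' Y Y' D} (f : X ⇒ X') (g : Y ⇒ Y') (k : (X' ⊕ Y') ⇒ D) → ι₂ ⨾ (f ⊕₁ g) ⨾ k ≡ g ⨾ ι₂ ⨾ k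
  ι₂-⊕₁-⨾ f g k = trans (ι₂-copair-⨾ _ _ k) (⨾-assoc _ _ _)

  ι₁-id⊕₁-⨾ : ∀ {X Y Y' D} (g : Y ⇒ Y') (k : (X ⊕ Y') ⇒ D) → ι₁ ⨾ (id ⊕₁ g) ⨾ k ≡ ι₁ ⨾ k
  ι₁-id⊕₁-⨾ g k = trans (ι₁-⊕₁-⨾ id g k) (⨾-idˡ _)

  ι₁-ι₁-α-⨾ : ∀ {X Y Z D} (k : (X ⊕ (Y ⊕ Z)) ⇒ D) → ι₁ ⨾ ι₁ ⨾ α X Y Z ⨾ k ≡ ι₁ ⨾ k
  ι₁-ι₁-α-⨾ k = trans (cong (ι₁ ⨾_) (ι₁-copair-⨾ _ _ k)) (ι₁-copair-⨾ _ _ k)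

  ι₂-ι₁-α-⨾ : ∀ {X Y Z D} (k : (X ⊕ (Y ⊕ Z)) ⇒ D) → ι₂ ⨾ ι₁ ⨾ α X Y Z ⨾ k ≡ ι₁ ⨾ ι₂ ⨾ k
  ι₂-ι₁-α-⨾ k = trans (cong (ι₂ ⨾_) (ι₁-copair-⨾ _ _ k)) (trans (ι₂-copair-⨾ _ _ k) (⨾-assoc _ _ _))

  ι₂-α-⨾ : ∀ {X Y Z D} (k : (X ⊕ (Y ⊕ Z)) ⇒ D) → ι₂ ⨾ α X Y Z ⨾ k ≡ ι₂ ⨾ ι₂ ⨾ k
  ι₂-α-⨾ k = trans (ι₂-copair-⨾ _ _ k) (⨾-assoc _ _ _)

  ι₁-α⁻¹-⨾ : ∀ {X Y Z D} (k : ((X ⊕ Y) ⊕ Z) ⇒ D) → ι₁ ⨾ α⁻¹ X Y Z ⨾ k ≡ ι₁ ⨾ ι₁ ⨾ k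
  ι₁-α⁻¹-⨾ k = trans (ι₁-copair-⨾ _ _ k) (⨾-assoc _ _ _)

  ι₁-ι₂-α⁻¹-⨾ : ∀ {X Y Z D} (k : ((X ⊕ Y) ⊕ Z) ⇒ D) → ι₁ ⨾ ι₂ ⨾ α⁻¹ X Y Z ⨾ k ≡ ι₂ ⨾ ι₁ ⨾ k
  ι₁-ι₂-α⁻¹-⨾ k = trans (cong (ι₁ ⨾_) (ι₂-copair-⨾ _ _ k)) (trans (ι₁-copair-⨾ _ _ k) (⨾-assoc _ _ _))

  ι₂-ι₂-α⁻¹-⨾ : ∀ {X Y Z D} (k : ((X ⊕ Y) ⊕ Z) ⇒ D) → ι₂ ⨾ ι₂ ⨾ α⁻¹ X Y Z ⨾ k ≡ ι₂ ⨾ k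
  ι₂-ι₂-α⁻¹-⨾ k = trans (cong (ι₂ ⨾_) (ι₂-copair-⨾ _ _ k)) (ι₂-copair-⨾ _ _ k)

  ι₁-ι₂-α⁻¹ : ∀ {X Y Z} → ι₁ ⨾ ι₂ ⨾ α⁻¹ X Y Z ≡ ι₂ ⨾ ι₁
  ι₁-ι₂-α⁻¹ = trans (cong (ι₁ ⨾_) (ι₂-copair _ _)) (ι₁-copair _ _)

  ι₂-ι₂-α⁻¹ : ∀ {X Y Z} → ι₂ ⨾ ι₂ ⨾ α⁻¹ X Y Z ≡ ι₂
  ι₂-ι₂-α⁻¹ = trans (cong (ι₂ ⨾_) (ι₂-copair _ _)) (ι₂-copair _ _)

  ι₁-σ-⨾ : ∀ {X Y D} (k : (Y ⊕ X) ⇒ D) → ι₁ ⨾ σ X Y ⨾ k ≡ ι₂ ⨾ k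
  ι₁-σ-⨾ = ι₁-copair-⨾ _ _

  ι₂-σ-⨾ : ∀ {X Y D} (k : (Y ⊕ X) ⇒ D) → ι₂ ⨾ σ X Y ⨾ k ≡ ι₁ ⨾ k
  ι₂-σ-⨾ = ι₂-copair-⨾ _ _

  Δ≡ι₁+ι₂ : ∀ {X p} → Open01 p → Δ X p ≡ ι₁ +⟨ p ⟩ ι₂
  Δ≡ι₁+ι₂ {p = p} 0<p<1 = sym (pair-unique p (1# - p) (Open01⇒Closed01 0<p<1)
    (Open01⇒Closed01 (Open01-complement 0<p<1)) (p+[1-p]≤1 p) id id (ι₁ +⟨ p ⟩ ι₂)
    (trans (⨾-+ˡ p 0<p<1 ι₁ ι₂ π₁) (cong₂ _+⟨ p ⟩_ ι₁-π₁ ι₂-π₁))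
    (trans (⨾-+ˡ p 0<p<1 ι₁ ι₂ π₂) (trans (cong₂ _+⟨ p ⟩_ ι₁-π₂ ι₂-π₂) (pca-comm p 0<p<1 ⋆ id))))

  Δ-⨾ : ∀ {X Z p} → Open01 p → (k : (X ⊕ X) ⇒ Z) → Δ X p ⨾ k ≡ (ι₁ ⨾ k) +⟨ p ⟩ (ι₂ ⨾ k)
  Δ-⨾ {p = p} 0<p<1 k = trans (cong (_⨾ k) (Δ≡ι₁+ι₂ 0<p<1)) (⨾-+ˡ p 0<p<1 ι₁ ι₂ k)

  Δ-copair : ∀ {X Z p} → Open01 p → (f g : X ⇒ Z) → Δ X p ⨾ [ f , g ] ≡ f +⟨ p ⟩ g
  Δ-copair {p = p} 0<p<1 f g = trans (Δ-⨾ 0<p<1 [ f , g ]) (cong₂ _+⟨ p ⟩_ (ι₁-copair f g) (ι₂-copair f g))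

  ⨾-Δ : ∀ {W X p} → Open01 p → (f : W ⇒ X) → f ⨾ Δ X p ≡ (f ⨾ ι₁) +⟨ p ⟩ (f ⨾ ι₂)
  ⨾-Δ {p = p} 0<p<1 f = trans (cong (f ⨾_) (Δ≡ι₁+ι₂ 0<p<1)) (⨾-+ʳ p 0<p<1 f ι₁ ι₂)

  ¡-unique₂ : ∀ {A} (f g : 𝟘 ⇒ A) → f ≡ g
  ¡-unique₂ f g = trans (¡-unique f) (sym (¡-unique g))

  Δ-∇ : ∀ {X p} → Open01 p → Δ X p ⨾ ∇ X ≡ id
  Δ-∇ {p = p} 0<p<1 = trans (Δ-copair 0<p<1 id id) (pca-idem p 0<p<1 id)

  Δ-σ : ∀ {X p} → Open01 p → Δ X p ⨾ σ X X ≡ Δ X (1# - p)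
  Δ-σ {p = p} 0<p<1 = begin
    Δ _ p ⨾ σ _ _           ≡⟨ Δ-copair 0<p<1 ι₂ ι₁ ⟩
    ι₂ +⟨ p ⟩ ι₁            ≡⟨ pca-comm p 0<p<1 ι₂ ι₁ ⟩
    ι₁ +⟨ 1# - p ⟩ ι₂       ≡⟨ Δ≡ι₁+ι₂ (Open01-complement 0<p<1) ⟨
    Δ _ (1# - p)            ∎
    where open ≡-Reasoning

  Δ-natural : ∀ {X Y p} → Open01 p → (f : X ⇒ Y) → f ⨾ Δ Y p ≡ Δ X p ⨾ (f ⊕₁ f)
  Δ-natural 0<p<1 f = trans (⨾-Δ 0<p<1 f) (sym (Δ-copair 0<p<1 (f ⨾ ι₁) (f ⨾ ι₂)))

  Δ-assoc : ∀ {X p q} → Open01 p → Open01 q →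
            Δ X p ⨾ (Δ X q ⊕₁ id) ≡ Δ X (p * q) ⨾ (id ⊕₁ Δ X (tilde p q)) ⨾ α⁻¹ X X X
  Δ-assoc {X} {p} {q} 0<p<1 0<q<1 = begin
    Δ X p ⨾ (Δ X q ⊕₁ id)                                 ≡⟨ Δ-copair 0<p<1 _ _ ⟩
    (Δ X q ⨾ ι₁) +⟨ p ⟩ (id ⨾ ι₂)                         ≡⟨ cong₂ _+⟨ p ⟩_ (Δ-⨾ 0<q<1 ι₁) (⨾-idˡ ι₂) ⟩
    ((ι₁ ⨾ ι₁) +⟨ q ⟩ (ι₂ ⨾ ι₁)) +⟨ p ⟩ ι₂                ≡⟨ pca-assoc p q 0<p<1 0<q<1 _ _ _ ⟩
    (ι₁ ⨾ ι₁) +⟨ p * q ⟩ ((ι₂ ⨾ ι₁) +⟨ q̃ ⟩ ι₂)            ≡⟨ cong₂ _+⟨ p * q ⟩_ (ι₁-copair _ _) (Δ-copair 0<q̃<1 _ _) ⟨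
    (ι₁ ⨾ α⁻¹ X X X) +⟨ p * q ⟩ (Δ X q̃ ⨾ [ ι₂ ⨾ ι₁ , ι₂ ]) ≡⟨ cong ((ι₁ ⨾ α⁻¹ X X X) +⟨ p * q ⟩_) (cong (Δ X q̃ ⨾_) (ι₂-copair _ _)) ⟨
    (ι₁ ⨾ α⁻¹ X X X) +⟨ p * q ⟩ (Δ X q̃ ⨾ ι₂ ⨾ α⁻¹ X X X)  ≡⟨ cong₂ _+⟨ p * q ⟩_ (ι₁-id⊕₁-⨾ _ _) (ι₂-⊕₁-⨾ _ _ _) ⟨
    (ι₁ ⨾ (id ⊕₁ Δ X q̃) ⨾ α⁻¹ X X X) +⟨ p * q ⟩ (ι₂ ⨾ (id ⊕₁ Δ X q̃) ⨾ α⁻¹ X X X)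
                                                           ≡⟨ Δ-⨾ (Open01-* 0<p<1 0<q<1) _ ⟨
    Δ X (p * q) ⨾ (id ⊕₁ Δ X q̃) ⨾ α⁻¹ X X X              ∎
    where
      open ≡-Reasoning
      q̃ = tilde p q
      0<q̃<1 : Open01 q̃
      0<q̃<1 = Open01-tilde 0<p<1 0<q<1

  module _ (X Y : Obj) where
    private
      tail₄ : (X ⊕ (Y ⊕ (X ⊕ Y))) ⇒ ((X ⊕ Y) ⊕ (X ⊕ Y))
      tail₄ = α⁻¹ X Y (X ⊕ Y)
      tail₃ : (X ⊕ ((Y ⊕ X) ⊕ Y)) ⇒ ((X ⊕ Y) ⊕ (X ⊕ Y))
      tail₃ = (id ⊕₁ α Y X Y) ⨾ tail₄
      tail₂ : (X ⊕ ((X ⊕ Y) ⊕ Y)) ⇒ ((X ⊕ Y) ⊕ (X ⊕ Y))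
      tail₂ = (id ⊕₁ (σ X Y ⊕₁ id)) ⨾ tail₃
      tail₁ : (X ⊕ (X ⊕ (Y ⊕ Y))) ⇒ ((X ⊕ Y) ⊕ (X ⊕ Y))
      tail₁ = (id ⊕₁ α⁻¹ X Y Y) ⨾ tail₂

    interchange : ((X ⊕ X) ⊕ (Y ⊕ Y)) ⇒ ((X ⊕ Y) ⊕ (X ⊕ Y))
    interchange = α X X (Y ⊕ Y) ⨾ tail₁

    interchange-ι₁ι₁ : ι₁ ⨾ ι₁ ⨾ interchange ≡ ι₁ ⨾ ι₁
    interchange-ι₁ι₁ = begin
      ι₁ ⨾ ι₁ ⨾ interchange    ≡⟨ ι₁-ι₁-α-⨾ _ ⟩
      ι₁ ⨾ tail₁               ≡⟨ ι₁-id⊕₁-⨾ _ _ ⟩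
      ι₁ ⨾ tail₂               ≡⟨ ι₁-id⊕₁-⨾ _ _ ⟩
      ι₁ ⨾ tail₃               ≡⟨ ι₁-id⊕₁-⨾ _ _ ⟩
      ι₁ ⨾ tail₄               ≡⟨ ι₁-copair _ _ ⟩
      ι₁ ⨾ ι₁                  ∎
      where open ≡-Reasoning

    interchange-ι₂ι₁ : ι₂ ⨾ ι₁ ⨾ interchange ≡ ι₁ ⨾ ι₂
    interchange-ι₂ι₁ = begin
      ι₂ ⨾ ι₁ ⨾ interchange                 ≡⟨ ι₂-ι₁-α-⨾ _ ⟩
      ι₁ ⨾ ι₂ ⨾ tail₁                       ≡⟨ cong (ι₁ ⨾_) (ι₂-⊕₁-⨾ _ _ _) ⟩
      ι₁ ⨾ α⁻¹ X Y Y ⨾ ι₂ ⨾ tail₂           ≡⟨ ι₁-α⁻¹-⨾ _ ⟩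
      ι₁ ⨾ ι₁ ⨾ ι₂ ⨾ tail₂                  ≡⟨ cong (λ k → ι₁ ⨾ ι₁ ⨾ k) (ι₂-⊕₁-⨾ _ _ _) ⟩
      ι₁ ⨾ ι₁ ⨾ (σ X Y ⊕₁ id) ⨾ ι₂ ⨾ tail₃  ≡⟨ cong (ι₁ ⨾_) (ι₁-⊕₁-⨾ _ _ _) ⟩
      ι₁ ⨾ σ X Y ⨾ ι₁ ⨾ ι₂ ⨾ tail₃          ≡⟨ ι₁-σ-⨾ _ ⟩
      ι₂ ⨾ ι₁ ⨾ ι₂ ⨾ tail₃                  ≡⟨ cong (λ k → ι₂ ⨾ ι₁ ⨾ k) (ι₂-⊕₁-⨾ _ _ _) ⟩
      ι₂ ⨾ ι₁ ⨾ α Y X Y ⨾ ι₂ ⨾ tail₄        ≡⟨ ι₂-ι₁-α-⨾ _ ⟩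
      ι₁ ⨾ ι₂ ⨾ ι₂ ⨾ tail₄                  ≡⟨ cong (ι₁ ⨾_) ι₂-ι₂-α⁻¹ ⟩
      ι₁ ⨾ ι₂                               ∎
      where open ≡-Reasoning

    interchange-ι₁ι₂ : ι₁ ⨾ ι₂ ⨾ interchange ≡ ι₂ ⨾ ι₁
    interchange-ι₁ι₂ = begin
      ι₁ ⨾ ι₂ ⨾ interchange                 ≡⟨ cong (ι₁ ⨾_) (ι₂-α-⨾ _) ⟩
      ι₁ ⨾ ι₂ ⨾ ι₂ ⨾ tail₁                  ≡⟨ cong (λ k → ι₁ ⨾ ι₂ ⨾ k) (ι₂-⊕₁-⨾ _ _ _) ⟩
      ι₁ ⨾ ι₂ ⨾ α⁻¹ X Y Y ⨾ ι₂ ⨾ tail₂      ≡⟨ ι₁-ι₂-α⁻¹-⨾ _ ⟩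
      ι₂ ⨾ ι₁ ⨾ ι₂ ⨾ tail₂                  ≡⟨ cong (λ k → ι₂ ⨾ ι₁ ⨾ k) (ι₂-⊕₁-⨾ _ _ _) ⟩
      ι₂ ⨾ ι₁ ⨾ (σ X Y ⊕₁ id) ⨾ ι₂ ⨾ tail₃  ≡⟨ cong (ι₂ ⨾_) (ι₁-⊕₁-⨾ _ _ _) ⟩
      ι₂ ⨾ σ X Y ⨾ ι₁ ⨾ ι₂ ⨾ tail₃          ≡⟨ ι₂-σ-⨾ _ ⟩
      ι₁ ⨾ ι₁ ⨾ ι₂ ⨾ tail₃                  ≡⟨ cong (λ k → ι₁ ⨾ ι₁ ⨾ k) (ι₂-⊕₁-⨾ _ _ _) ⟩
      ι₁ ⨾ ι₁ ⨾ α Y X Y ⨾ ι₂ ⨾ tail₄        ≡⟨ ι₁-ι₁-α-⨾ _ ⟩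
      ι₁ ⨾ ι₂ ⨾ tail₄                       ≡⟨ ι₁-ι₂-α⁻¹ ⟩
      ι₂ ⨾ ι₁                               ∎
      where open ≡-Reasoning

    interchange-ι₂ι₂ : ι₂ ⨾ ι₂ ⨾ interchange ≡ ι₂ ⨾ ι₂
    interchange-ι₂ι₂ = begin
      ι₂ ⨾ ι₂ ⨾ interchange                 ≡⟨ cong (ι₂ ⨾_) (ι₂-α-⨾ _) ⟩
      ι₂ ⨾ ι₂ ⨾ ι₂ ⨾ tail₁                  ≡⟨ cong (λ k → ι₂ ⨾ ι₂ ⨾ k) (ι₂-⊕₁-⨾ _ _ _) ⟩
      ι₂ ⨾ ι₂ ⨾ α⁻¹ X Y Y ⨾ ι₂ ⨾ tail₂      ≡⟨ ι₂-ι₂-α⁻¹-⨾ _ ⟩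
      ι₂ ⨾ ι₂ ⨾ tail₂                       ≡⟨ cong (ι₂ ⨾_) (ι₂-⊕₁-⨾ _ _ _) ⟩
      ι₂ ⨾ (σ X Y ⊕₁ id) ⨾ ι₂ ⨾ tail₃       ≡⟨ ι₂-⊕₁-⨾ _ _ _ ⟩
      id ⨾ ι₂ ⨾ ι₂ ⨾ tail₃                  ≡⟨ ⨾-idˡ _ ⟩
      ι₂ ⨾ ι₂ ⨾ tail₃                       ≡⟨ cong (ι₂ ⨾_) (ι₂-⊕₁-⨾ _ _ _) ⟩
      ι₂ ⨾ α Y X Y ⨾ ι₂ ⨾ tail₄             ≡⟨ ι₂-α-⨾ _ ⟩
      ι₂ ⨾ ι₂ ⨾ ι₂ ⨾ tail₄                  ≡⟨ cong (ι₂ ⨾_) ι₂-ι₂-α⁻¹ ⟩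
      ι₂ ⨾ ι₂                               ∎
      where open ≡-Reasoning

    Δ-⊕ : ∀ {p} → Open01 p → Δ (X ⊕ Y) p ≡ (Δ X p ⊕₁ Δ Y p) ⨾ interchange
    Δ-⊕ {p} 0<p<1 = copair-ext
      (begin
        ι₁ ⨾ Δ (X ⊕ Y) p                                           ≡⟨ ⨾-Δ 0<p<1 ι₁ ⟩
        (ι₁ ⨾ ι₁) +⟨ p ⟩ (ι₁ ⨾ ι₂)                                 ≡⟨ cong₂ _+⟨ p ⟩_ interchange-ι₁ι₁ interchange-ι₂ι₁ ⟨
        (ι₁ ⨾ ι₁ ⨾ interchange) +⟨ p ⟩ (ι₂ ⨾ ι₁ ⨾ interchange)      ≡⟨ Δ-⨾ 0<p<1 _ ⟨
        Δ X p ⨾ ι₁ ⨾ interchange                                   ≡⟨ ι₁-⊕₁-⨾ _ _ _ ⟨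
        ι₁ ⨾ (Δ X p ⊕₁ Δ Y p) ⨾ interchange                        ∎)
      (begin
        ι₂ ⨾ Δ (X ⊕ Y) p                                           ≡⟨ ⨾-Δ 0<p<1 ι₂ ⟩
        (ι₂ ⨾ ι₁) +⟨ p ⟩ (ι₂ ⨾ ι₂)                                 ≡⟨ cong₂ _+⟨ p ⟩_ interchange-ι₁ι₂ interchange-ι₂ι₂ ⟨
        (ι₁ ⨾ ι₂ ⨾ interchange) +⟨ p ⟩ (ι₂ ⨾ ι₂ ⨾ interchange)      ≡⟨ Δ-⨾ 0<p<1 _ ⟨
        Δ Y p ⨾ ι₂ ⨾ interchange                                   ≡⟨ ι₂-⊕₁-⨾ _ _ _ ⟨
        ι₂ ⨾ (Δ X p ⊕₁ Δ Y p) ⨾ interchange                        ∎)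
      where open ≡-Reasoning

proposition1 : ∀ {o h : Level} (ℝ : RealField) (C : ConvexBiproductCategory ℝ o h) →
  let open RealField ℝ
      open ConvexBiproductCategory C
  in ∀ (X Y : Obj) (p q : R) → Open01 p → Open01 q → (f : X ⇒ Y) →
     (Δ X p ⨾ (Δ X q ⊕₁ id) ≡ Δ X (p * q) ⨾ (id ⊕₁ Δ X (tilde p q)) ⨾ α⁻¹ X X X)
     × (Δ X p ⨾ ∇ X ≡ id)
     × (Δ X p ⨾ σ X X ≡ Δ X (1# - p))
     × (Δ (X ⊕ Y) p ≡ (Δ X p ⊕₁ Δ Y p) ⨾ α X X (Y ⊕ Y) ⨾ (id ⊕₁ α⁻¹ X Y Y)
                       ⨾ (id ⊕₁ (σ X Y ⊕₁ id)) ⨾ (id ⊕₁ α Y X Y) ⨾ α⁻¹ X Y (X ⊕ Y))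
     × ((! (X ⊕ Y)) ≡ ((! X) ⊕₁ (! Y)) ⨾ λu 𝟘)
     × ((! 𝟘) ≡ id)
     × (Δ 𝟘 p ≡ λu⁻¹ 𝟘)
     × (f ⨾ Δ Y p ≡ Δ X p ⨾ (f ⊕₁ f))
     × (f ⨾ (! Y) ≡ (! X))
proposition1 ℝ C X Y p q 0<p<1 0<q<1 f =
  Δ-assoc 0<p<1 0<q<1 , Δ-∇ 0<p<1 , Δ-σ 0<p<1 , Δ-⊕ X Y 0<p<1 ,
  sym (!ₜ-unique _) , sym (!ₜ-unique id) , ¡-unique₂ _ _ ,
  Δ-natural 0<p<1 f , !ₜ-unique _
  where
    open ConvexBiproductCategory C
    open CoPCA ℝ C
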